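{- Let $S$ be a set of formulas and let $M, A$ be sets of literals with $M \cup A \subseteq \mathcal{A}$. If $M$ is $\mathcal{T}$-satisfiable, then $S \cup M$ is $\mathcal{T}$-unsatisfiable if and only if $\mathcal{P}_{M,A}(S) = \{\overline{M}\}$. If $M$ is $\mathcal{T}$-unsatisfiable, then $\mathcal{P}_{M,A}(S) = \emptyset$.
   Context: $\mathcal{T}$ is a theory over a sorted signature; formulas are ground and quantifier-free. $\models_{\mathcal T}$ denotes entailment in all models of $\mathcal T$. A set of formulas is $\mathcal T$-satisfiable if it has a model that is also a model of $\mathcal T$, and $\mathcal T$-unsatisfiable otherwise. Clauses are finite disjunctions of literals without repetition, identified with sets of literals; $\bot$ is the empty clause. For a literal $l$, $\overline{l}$ is its complementary literal. For a set of literals $Q=\{l_1,\dots,l_n\}$, $\overline{Q}$ is the clause $\overline{l_1}\vee\dots\vee\overline{l_n}$. For a clause $C$, $\overline{C}$ is the set of complements of its literals. $\mathcal A$ is a fixed finite set of literals (abducible literals), each of which is $\mathcal T$-satisfiable. A clause $C$ is a $(\mathcal T,\mathcal A)$-implicate of a set of formulas $S$ if $\overline{C}\subseteq\mathcal A$ and $S\models_{\mathcal T} C$. $\mathcal I(S)$ denotes the set of these implicates. A $\mathcal T$-tautology is a clause satisfied by every model of $\mathcal T$. Fix an order $\prec$ on clauses built on $\mathcal A$ such that $C\subsetneq D$ implies $C\prec D$. For a set of clauses $S$, $\mathrm{SubMin}(S)$ is obtained from $S$ by deleting every clause $D$ that either is a $\mathcal T$-tautology, or for which there exists $C\in S$ with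 $C\models_{\mathcal T} D$ and ($D\not\models_{\mathcal T} C$ or $C\prec D$). For a set of formulas $S$ and sets of literals $M,A$ with $M\cup A\subseteq\mathcal A$: - $\mathcal I_{M,A}(S)=\{C\in\mathcal I(S) \mid \exists Q\subseteq A,\ C=\overline{M}\vee\overline{Q}\}$; - $\mathcal P_{M,A}(S)=\mathrm{SubMin}(\mathcal I_{M,A}(S))$. -}

module Defs where

open import Data.Bool using (Bool; true; false; not)
open import Data.Nat using (ℕ)
open import Data.Fin using (Fin)
open import Data.Fin.Subset using (Subset; _∈_; _⊆_; _⊂_; _∪_)
open import Data.Product using (Σ; ∃; _×_; _,_)
open import Data.Sum using (_⊎_)
open import Relation.Nullary using (¬_)
open import Relation.Binary.PropositionalEquality using (_≡_)
open import Relation.Binary.Structures using (IsStrictPartialOrder)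
open import Function.Definitions using (Injective)

-- The abstract setting:
--  * Lit      : the ground literals of the (sorted) signature, with complement ‾_
--  * Mod      : the models of the theory 𝒯 (each assigns a truth value to literals)
--  * Formula  : ground quantifier-free formulas, with satisfaction _⊨F_
--  * the finite set 𝒜 of abducible literals, enumerated injectively as ab : Fin n → Lit,
--    each 𝒜-literal being 𝒯-satisfiable
--  * a strict order _≺_ on clauses built on 𝒜 with C ⊊ D ⇒ C ≺ D.
-- A clause C with C̄ ⊆ 𝒜 is represented by the subset X ⊆ Fin n such that
-- C = ⋁_{i ∈ X} ‾ (ab i); sets of literals M ⊆ 𝒜 by the subset of indices.
record Setting : Set₁ where
  field
    Lit     : Set
    ‾_      : Lit → Lit
    Mod     : Set
    val     : Mod → Lit → Bool
    val-‾   : ∀ m l → val m (‾ l) ≡ not (val m l)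
    Formula : Set
    _⊨F_    : Mod → Formula → Set
    n       : ℕ
    ab      : Fin n → Lit
    ab-inj  : Injective _≡_ _≡_ ab
    ab-sat  : ∀ i → ∃ λ m → val m (ab i) ≡ true
    _≺_     : Subset n → Subset n → Set
    ≺-spo   : IsStrictPartialOrder _≡_ _≺_
    ⊂⇒≺     : ∀ {C D} → C ⊂ D → C ≺ D

module _ (Σ𝒯 : Setting) where
  open Setting Σ𝒯

  Clause : Set
  Clause = Subset n

  FormulaSet : Set₁
  FormulaSet = Formula → Set

  _⊨C_ : Mod → Clause → Set
  m ⊨C C = ∃ λ i → i ∈ C × val m (‾ ab i) ≡ true

  _⊨S_ : Mod → FormulaSet → Set
  m ⊨S S = ∀ φ → S φ → m ⊨F φ

  _⊨𝒯_ : FormulaSet → Clause → Set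
  S ⊨𝒯 C = ∀ m → m ⊨S S → m ⊨C C

  _⊨CC_ : Clause → Clause → Set
  C ⊨CC D = ∀ m → m ⊨C C → m ⊨C D

  Tautology : Clause → Set
  Tautology C = ∀ m → m ⊨C C

  LitsSat : Subset n → Set
  LitsSat M = ∃ λ m → ∀ i → i ∈ M → val m (ab i) ≡ true

  SatUnion : FormulaSet → Subset n → Set
  SatUnion S M = ∃ λ m → m ⊨S S × (∀ i → i ∈ M → val m (ab i) ≡ true)

  -- (𝒯,𝒜)-implicates of S  (the condition C̄ ⊆ 𝒜 is built into the representation)
  ℐ : FormulaSet → Clause → Set
  ℐ S C = S ⊨𝒯 C

  ℐ[_,_] : Subset n → Subset n → FormulaSet → Clause → Set
  ℐ[ M , A ] S C = ℐ S C × ∃ λ Q → Q ⊆ A × C ≡ M ∪ Q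

  SubMin : (Clause → Set) → Clause → Set
  SubMin 𝒮 D = 𝒮 D × ¬ Tautology D
             × ¬ (∃ λ C → 𝒮 C × C ⊨CC D × (¬ (D ⊨CC C) ⊎ C ≺ D))

  𝒫[_,_] : Subset n → Subset n → FormulaSet → Clause → Set
  𝒫[ M , A ] S = SubMin (ℐ[ M , A ] S)

module Submission where

-- Everything rests on one observation about a single
-- model m of 𝒯: either m makes every literal of M true, or m satisfies the
-- clause M̄, and never both.  Consequently
--   * S ∪ M is unsatisfiable iff S ⊨𝒯 M̄, and M is unsatisfiable iff M̄ is a
--     𝒯-tautology;
--   * every clause of ℐ_{M,A}(S) has the form M̄ ∨ Q̄, so it contains M̄.
-- Independently of implicates we show two facts about SubMin: if a family of
-- clauses has a ⊆-least member L that is not a tautology, then SubMin keeps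
-- exactly L (supersets of L are entailed by L, and strictly larger ones are
-- ≻ L by the compatibility of ≺ with ⊊); and if every member contains a
-- tautology, then SubMin is empty.  The theorem follows by taking L = M̄,
-- which lies in ℐ_{M,A}(S) exactly when S ∪ M is unsatisfiable.

open import Defs
open import Data.Fin.Subset using (Subset)
open import Data.Product using (_×_)
open import Relation.Nullary using (¬_)
open import Relation.Binary.PropositionalEquality using (_≡_)
open import Function.Bundles using (_⇔_)

open import Data.Bool using (true; not)
open import Data.Bool.Properties using (not-injective; not-¬; ¬-not)
import Data.Bool.Properties as Bool
open import Data.Empty using (⊥-elim)
open import Data.Fin.Properties using (any?)
open import Data.Fin.Subset using (_∈_; _⊆_; _⊂_; ⊥)
open import Data.Fin.Subset.Properties using (_∈?_; _⊂?_; ⊆-antisym; p⊆p∪q; ⊥⊆; ∪-identityʳ)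
open import Data.Product using (_,_; proj₁)
open import Data.Sum using (_⊎_; inj₁; inj₂)
open import Function.Bundles using (mk⇔; Equivalence)
open import Relation.Nullary using (yes; no)
open import Relation.Nullary.Decidable using (_×-dec_; decidable-stable)
open import Relation.Binary.PropositionalEquality using (refl; sym; trans; cong; subst; _≢_)
open import Relation.Binary.Structures using (IsStrictPartialOrder)

⊆⇒≡⊎⊂ : ∀ {k} {L C : Subset k} → L ⊆ C → C ≡ L ⊎ L ⊂ C
⊆⇒≡⊎⊂ {L = L} {C} L⊆C with L ⊂? C
... | yes L⊂C = inj₂ L⊂C
... | no  L⊄C = inj₁ (⊆-antisym C⊆L L⊆C)
  where
  C⊆L : C ⊆ L
  C⊆L {x} x∈C = decidable-stable (x ∈? L) (λ x∉L → L⊄C (L⊆C , x , x∈C , x∉L))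

module _ (Σ𝒯 : Setting) where
  open Setting Σ𝒯
  open IsStrictPartialOrder ≺-spo using (irrefl) renaming (trans to ≺-trans)

  _⊨L_ : Mod → Subset n → Set
  m ⊨L M = ∀ i → i ∈ M → val m (ab i) ≡ true

  complement-true⇔ : ∀ m l → val m (‾ l) ≡ true ⇔ val m l ≢ true
  complement-true⇔ m l = mk⇔
    (λ ‾l-true l-true → not-¬ l-true (not-injective (trans (sym (val-‾ m l)) ‾l-true)))
    (λ l-not-true → trans (val-‾ m l) (cong not (¬-not l-not-true)))

  ⊨C-mono : ∀ {m} {C D : Clause Σ𝒯} → C ⊆ D → _⊨C_ Σ𝒯 m C → _⊨C_ Σ𝒯 m D
  ⊨C-mono C⊆D (i , i∈C , ‾abi-true) = i , C⊆D i∈C , ‾abi-true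

  tautology-mono : ∀ {C D : Clause Σ𝒯} → C ⊆ D → Tautology Σ𝒯 C → Tautology Σ𝒯 D
  tautology-mono C⊆D taut m = ⊨C-mono C⊆D (taut m)

  ⊨L⇒⊭C : ∀ {m M} → m ⊨L M → ¬ _⊨C_ Σ𝒯 m M
  ⊨L⇒⊭C {m} m⊨M (i , i∈M , ‾abi-true) =
    Equivalence.to (complement-true⇔ m (ab i)) ‾abi-true (m⊨M i i∈M)

  ⊨L⊎⊨C : ∀ m M → m ⊨L M ⊎ _⊨C_ Σ𝒯 m M
  ⊨L⊎⊨C m M with any? (λ i → (i ∈? M) ×-dec (val m (‾ ab i) Bool.≟ true))
  ... | yes m⊨M̄ = inj₂ m⊨M̄
  ... | no  m⊭M̄ = inj₁ λ i i∈M → decidable-stable (val m (ab i) Bool.≟ true)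
        λ abi-not-true → m⊭M̄ (i , i∈M , Equivalence.from (complement-true⇔ m (ab i)) abi-not-true)

  unsat⇔entails : ∀ (S : FormulaSet Σ𝒯) M → (¬ SatUnion Σ𝒯 S M) ⇔ _⊨𝒯_ Σ𝒯 S M
  unsat⇔entails S M = mk⇔ entails unsat
    where
    entails : ¬ SatUnion Σ𝒯 S M → _⊨𝒯_ Σ𝒯 S M
    entails ¬sat m m⊨S with ⊨L⊎⊨C m M
    ... | inj₁ m⊨M = ⊥-elim (¬sat (m , m⊨S , m⊨M))
    ... | inj₂ m⊨M̄ = m⊨M̄
    unsat : _⊨𝒯_ Σ𝒯 S M → ¬ SatUnion Σ𝒯 S M
    unsat S⊨M̄ (m , m⊨S , m⊨M) = ⊨L⇒⊭C m⊨M (S⊨M̄ m m⊨S)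

  unsat⇔tautology : ∀ M → (¬ LitsSat Σ𝒯 M) ⇔ Tautology Σ𝒯 M
  unsat⇔tautology M = mk⇔ tautology unsat
    where
    tautology : ¬ LitsSat Σ𝒯 M → Tautology Σ𝒯 M
    tautology ¬sat m with ⊨L⊎⊨C m M
    ... | inj₁ m⊨M = ⊥-elim (¬sat (m , m⊨M))
    ... | inj₂ m⊨M̄ = m⊨M̄
    unsat : Tautology Σ𝒯 M → ¬ LitsSat Σ𝒯 M
    unsat taut (m , m⊨M) = ⊨L⇒⊭C m⊨M (taut m)

  -- A clause strictly below a subclause would be strictly below itself.
  ⊆⇒⊀ : ∀ {L C : Clause Σ𝒯} → L ⊆ C → ¬ C ≺ L
  ⊆⇒⊀ L⊆C C≺L with ⊆⇒≡⊎⊂ L⊆C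
  ... | inj₁ C≡L = irrefl C≡L C≺L
  ... | inj₂ L⊂C = irrefl refl (≺-trans (⊂⇒≺ L⊂C) C≺L)

  SubMin-least : (𝒮 : Clause Σ𝒯 → Set) (L : Clause Σ𝒯) → 𝒮 L →
                 (∀ C → 𝒮 C → L ⊆ C) → ¬ Tautology Σ𝒯 L →
                 ∀ C → SubMin Σ𝒯 𝒮 C ⇔ C ≡ L
  SubMin-least 𝒮 L L∈𝒮 least ¬taut C = mk⇔ only-L L-kept
    where
    L⊨ : ∀ {D} → L ⊆ D → _⊨CC_ Σ𝒯 L D
    L⊨ L⊆D _ = ⊨C-mono L⊆D

    only-L : SubMin Σ𝒯 𝒮 C → C ≡ L
    only-L (C∈𝒮 , _ , C-minimal) with ⊆⇒≡⊎⊂ (least C C∈𝒮)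
    ... | inj₁ C≡L = C≡L
    ... | inj₂ L⊂C = ⊥-elim (C-minimal (L , L∈𝒮 , L⊨ (proj₁ L⊂C) , inj₂ (⊂⇒≺ L⊂C)))

    L-kept : C ≡ L → SubMin Σ𝒯 𝒮 C
    L-kept refl = L∈𝒮 , ¬taut , λ where
      (D , D∈𝒮 , _ , inj₁ L⊭D) → L⊭D (L⊨ (least D D∈𝒮))
      (D , D∈𝒮 , _ , inj₂ D≺L) → ⊆⇒⊀ (least D D∈𝒮) D≺L

  SubMin-empty : (𝒮 : Clause Σ𝒯 → Set) (L : Clause Σ𝒯) → Tautology Σ𝒯 L →
                 (∀ C → 𝒮 C → L ⊆ C) → ∀ C → ¬ SubMin Σ𝒯 𝒮 C
  SubMin-empty 𝒮 L taut least C (C∈𝒮 , ¬taut , _) = ¬taut (tautology-mono (least C C∈𝒮) taut)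

  module _ (S : FormulaSet Σ𝒯) (M A : Subset n) where

    ℐ-contains-M : ∀ C → ℐ[_,_] Σ𝒯 M A S C → M ⊆ C
    ℐ-contains-M C (_ , Q , _ , C≡M∪Q) = subst (M ⊆_) (sym C≡M∪Q) (p⊆p∪q Q)

    M∈ℐ : _⊨𝒯_ Σ𝒯 S M → ℐ[_,_] Σ𝒯 M A S M
    M∈ℐ S⊨M̄ = S⊨M̄ , ⊥ , ⊥⊆ , sym (∪-identityʳ M)

proposition2 : (Σ𝒯 : Setting) → let open Setting Σ𝒯 in
    (S : FormulaSet Σ𝒯) (M A : Subset n) →
      (LitsSat Σ𝒯 M →
         (¬ SatUnion Σ𝒯 S M) ⇔ (∀ C → 𝒫[_,_] Σ𝒯 M A S C ⇔ C ≡ M))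
      × (¬ LitsSat Σ𝒯 M → ∀ C → ¬ 𝒫[_,_] Σ𝒯 M A S C)
proposition2 Σ𝒯 S M A = satisfiable-case , unsatisfiable-case
  where
  open Equivalence

  satisfiable-case : LitsSat Σ𝒯 M →
                     (¬ SatUnion Σ𝒯 S M) ⇔ (∀ C → 𝒫[_,_] Σ𝒯 M A S C ⇔ C ≡ M)
  satisfiable-case M-sat = mk⇔
    (λ unsat → SubMin-least Σ𝒯 (ℐ[_,_] Σ𝒯 M A S) M
                 (M∈ℐ Σ𝒯 S M A (to (unsat⇔entails Σ𝒯 S M) unsat))
                 (ℐ-contains-M Σ𝒯 S M A)
                 (λ taut → from (unsat⇔tautology Σ𝒯 M) taut M-sat))
    (λ 𝒫-is-M̄ → from (unsat⇔entails Σ𝒯 S M) (proj₁ (proj₁ (from (𝒫-is-M̄ M) refl))))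

  unsatisfiable-case : ¬ LitsSat Σ𝒯 M → ∀ C → ¬ 𝒫[_,_] Σ𝒯 M A S C
  unsatisfiable-case M-unsat = SubMin-empty Σ𝒯 (ℐ[_,_] Σ𝒯 M A S) M
    (to (unsat⇔tautology Σ𝒯 M) M-unsat) (ℐ-contains-M Σ𝒯 S M A)
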